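{- There exists a first-order formula $\mu(x,y,z)$ of vocabulary $\{A,M\}$ such that for every partial model of arithmetic $\mathfrak{N}$ with $n=|\mathrm{Dom}(\mathfrak{N})|$, the relation $\mu^{\mathfrak{N}}$ is a partial multiplication and for all $a,b\in\mathrm{Dom}(\mathfrak{N})\setminus\{0\}$: (a) $\gamma(\mu^{\mathfrak{N}},a)\ge\gamma(M^{\mathfrak{N}},a)$; (b) $\gamma(\mu^{\mathfrak{N}},a)\ge b$ if and only if $\gamma(\mu^{\mathfrak{N}},b)\ge a$; (c) if $a<b\le a^2+a$, then $\gamma(\mu^{\mathfrak{N}},b)\ge\min\left\{\left\lfloor\frac{\gamma(M^{\mathfrak{N}},a)}{\lfloor (b-1)/a\rfloor}\right\rfloor,\ \left\lfloor\frac{n-1}{b}\right\rfloor\right\}$.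
   Context: A partial multiplication is a ternary relation $R\subseteq\mathbb{N}^3$ such that $(a,b,c)\in R$ implies $ab=c$. For a partial multiplication $R$ and $k\in\mathbb{N}$, $\gamma(R,k)$ is the largest $r\in\mathbb{N}$ such that $r=0$ or for all $a,b\in\mathbb{N}$ with $a\le k$ and $b\le r$ we have $(a,b,ab)\in R$. $A,M$ are ternary relation symbols. A partial model of arithmetic is a finite $\{A,M\}$-structure $\mathfrak{N}$ with $\mathrm{Dom}(\mathfrak{N})=\{0,\dots,n-1\}$, $A^{\mathfrak{N}}=\{(a,b,c)\in\mathrm{Dom}(\mathfrak{N})^3:a+b=c\}$ and $M^{\mathfrak{N}}$ a partial multiplication. $\mu^{\mathfrak{N}}$ is the set of triples satisfying $\mu$ in $\mathfrak{N}$. -}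

module Defs where

open import Data.Nat using (ℕ; zero; suc; _+_; _*_; _∸_; _≤_; _<_; _/_)
open import Data.Fin using (Fin; toℕ)
open import Data.Vec.Functional using (Vector; _∷_; [])
open import Data.Product using (Σ; _×_; _,_)
open import Data.Sum using (_⊎_)
open import Relation.Nullary using (¬_; Dec)
open import Relation.Binary.PropositionalEquality using (_≡_)

-- First-order formulas of vocabulary {A, M} (relational, with equality),
-- with variables as de Bruijn indices: Formula k has free variables
-- among Fin k.  The variable bound by a quantifier is index zero.

data Formula (k : ℕ) : Set where
  A    : Fin k → Fin k → Fin k → Formula k
  M    : Fin k → Fin k → Fin k → Formula k
  _≐_  : Fin k → Fin k → Formula k
  ¬'_  : Formula k → Formula k
  _∧'_ : Formula k → Formula k → Formula k
  _∨'_ : Formula k → Formula k → Formula k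
  _⇒'_ : Formula k → Formula k → Formula k
  ∃'   : Formula (suc k) → Formula k
  ∀'   : Formula (suc k) → Formula k

PartialMultiplication : (ℕ → ℕ → ℕ → Set) → Set
PartialMultiplication R = ∀ a b c → R a b c → a * b ≡ c

GammaCond : (ℕ → ℕ → ℕ → Set) → ℕ → ℕ → Set
GammaCond R k r = r ≡ 0 ⊎ (∀ a b → a ≤ k → b ≤ r → R a b (a * b))

IsGamma : (ℕ → ℕ → ℕ → Set) → ℕ → ℕ → Set
IsGamma R k r = GammaCond R k r × (∀ r' → GammaCond R k r' → r' ≤ r)

-- Partial models of arithmetic: domain {0,…,n-1}, A the graph of
-- addition restricted to the domain, M a (decidable, since finite)
-- partial multiplication contained in the domain.

record PartialModel : Set₁ where
  field
    n     : ℕ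
    Mrel  : ℕ → ℕ → ℕ → Set
    M-dec : ∀ a b c → Dec (Mrel a b c)
    M-dom : ∀ a b c → Mrel a b c → a < n × b < n × c < n
    M-mul : PartialMultiplication Mrel

  Arel : ℕ → ℕ → ℕ → Set
  Arel a b c = a < n × b < n × c < n × a + b ≡ c

open PartialModel public

Sat : (𝔑 : PartialModel) {k : ℕ} → Formula k → Vector (Fin (n 𝔑)) k → Set
Sat 𝔑 (A x y z) ρ = Arel 𝔑 (toℕ (ρ x)) (toℕ (ρ y)) (toℕ (ρ z))
Sat 𝔑 (M x y z) ρ = Mrel 𝔑 (toℕ (ρ x)) (toℕ (ρ y)) (toℕ (ρ z))
Sat 𝔑 (x ≐ y) ρ = ρ x ≡ ρ y
Sat 𝔑 (¬' φ) ρ = ¬ Sat 𝔑 φ ρ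
Sat 𝔑 (φ ∧' ψ) ρ = Sat 𝔑 φ ρ × Sat 𝔑 ψ ρ
Sat 𝔑 (φ ∨' ψ) ρ = Sat 𝔑 φ ρ ⊎ Sat 𝔑 ψ ρ
Sat 𝔑 (φ ⇒' ψ) ρ = Sat 𝔑 φ ρ → Sat 𝔑 ψ ρ
Sat 𝔑 (∃' φ) ρ = Σ (Fin (n 𝔑)) λ d → Sat 𝔑 φ (d ∷ ρ)
Sat 𝔑 (∀' φ) ρ = (d : Fin (n 𝔑)) → Sat 𝔑 φ (d ∷ ρ)

-- μ^𝔑 : the set of triples (as natural numbers) satisfying μ(x,y,z),
-- where x,y,z are the variables 0,1,2.
_^_ : Formula 3 → (𝔑 : PartialModel) → ℕ → ℕ → ℕ → Set
(μ ^ 𝔑) a b c = Σ (Fin (n 𝔑)) λ i → Σ (Fin (n 𝔑)) λ j → Σ (Fin (n 𝔑)) λ l →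
  toℕ i ≡ a × toℕ j ≡ b × toℕ l ≡ c × Sat 𝔑 μ (i ∷ j ∷ l ∷ [])

-- floor division, with the (unused) convention m ⌊/⌋ 0 = 0
_⌊/⌋_ : ℕ → ℕ → ℕ
m ⌊/⌋ zero = 0
m ⌊/⌋ suc d = m / suc d

{-# OPTIONS --safe #-}
-- μ(x,y,z) says, for x,y in either order: M(x,y,z); or y = z = 0; or x = a q + r and
-- z = a (q y) + r y, each product being an M-fact. Every disjunct implies xy = z, and the
-- symmetry of μ gives (b). For (c), if M contains the table [0,a] × [0,γ(M,a)] and x ≤ b,
-- write x = a q + r with 1 ≤ r ≤ a; then q ≤ (b-1)/a ≤ a, so when q c ≤ γ(M,a) and b c < n
-- all four products a q, q c, a (q c), r c lie in that table and witness μ(x, c, x c).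
module Submission where

open import Defs
open import Data.Nat using (ℕ; zero; suc; _+_; _*_; _∸_; _≤_; _<_; _⊓_; z≤n; s≤s; s≤s⁻¹; NonZero; >-nonZero; _/_; _%_)
open import Data.Nat.Properties
open import Data.Nat.DivMod
open import Data.Fin using (Fin; toℕ; fromℕ<; #_; _↑ʳ_)
open import Data.Fin.Properties using (toℕ<n; toℕ-fromℕ<)
open import Data.Vec.Functional using (Vector; _∷_; [])
open import Data.Product using (Σ; _×_; _,_)
open import Data.Sum using (inj₁; inj₂)
open import Relation.Binary.PropositionalEquality
open import Function.Bundles using (_⇔_; mk⇔)

MulTable : (ℕ → ℕ → ℕ → Set) → ℕ → ℕ → Set
MulTable R k r = ∀ a b → a ≤ k → b ≤ r → R a b (a * b)

GammaCond⇒MulTable : ∀ {R k r} → 0 < r → GammaCond R k r → MulTable R k r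
GammaCond⇒MulTable () (inj₁ refl)
GammaCond⇒MulTable _  (inj₂ table) = table

GammaCond-antitone : ∀ {R k r s} → s ≤ r → GammaCond R k r → GammaCond R k s
GammaCond-antitone s≤r (inj₁ refl)  = inj₁ (n≤0⇒n≡0 s≤r)
GammaCond-antitone s≤r (inj₂ table) = inj₂ λ a b a≤k b≤s → table a b a≤k (≤-trans b≤s s≤r)

GammaCond-mono : ∀ {R S k r} → (∀ {a b c} → R a b c → S a b c) → GammaCond R k r → GammaCond S k r
GammaCond-mono R⊆S (inj₁ r≡0)  = inj₁ r≡0
GammaCond-mono R⊆S (inj₂ table) = inj₂ λ a b a≤k b≤r → R⊆S (table a b a≤k b≤r)

IsGamma-mono : ∀ {R S k g h} → (∀ {a b c} → R a b c → S a b c) →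
  IsGamma R k g → IsGamma S k h → g ≤ h
IsGamma-mono {R} {S} R⊆S (condR , _) (_ , maximalS) = maximalS _ (GammaCond-mono {R} {S} R⊆S condR)

GammaCond-transpose : ∀ {R k r} → (∀ {a b c} → R a b c → R b a c) → 0 < r →
  GammaCond R k r → GammaCond R r k
GammaCond-transpose {R} R-swap 0<r cond = inj₂ λ a b a≤r b≤k →
  subst (R a b) (*-comm b a) (R-swap (GammaCond⇒MulTable {R} 0<r cond b a b≤k a≤r))

IsGamma-transpose : ∀ {R a b ga gb} → (∀ {x y z} → R x y z → R y x z) → 0 < a → 0 < b →
  IsGamma R a ga → IsGamma R b gb → (b ≤ ga ⇔ a ≤ gb)
IsGamma-transpose {R} R-swap 0<a 0<b (condA , maximalA) (condB , maximalB) = mk⇔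
  (λ b≤ga → maximalB _ (GammaCond-transpose {R} R-swap 0<b (GammaCond-antitone {R} b≤ga condA)))
  (λ a≤gb → maximalA _ (GammaCond-transpose {R} R-swap 0<a (GammaCond-antitone {R} a≤gb condB)))

m+m≡m⇒m≡0 : ∀ m → m + m ≡ m → m ≡ 0
m+m≡m⇒m≡0 m m+m≡m = +-cancelˡ-≡ m m 0 (trans m+m≡m (sym (+-identityʳ m)))

[a*q+r]*y≡a*[q*y]+r*y : ∀ a q r y → (a * q + r) * y ≡ a * (q * y) + r * y
[a*q+r]*y≡a*[q*y]+r*y a q r y = trans (*-distribʳ-+ y (a * q) r) (cong (_+ r * y) (*-assoc a q y))

quotient-product : ∀ a q r y {s t u v x z} → a * q ≡ s → s + r ≡ x →
  q * y ≡ t → a * t ≡ u → r * y ≡ v → u + v ≡ z → x * y ≡ z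
quotient-product a q r y refl refl refl refl refl refl = [a*q+r]*y≡a*[q*y]+r*y a q r y

≤⌊/⌋⇒*≤ : ∀ {m c} d .{{_ : NonZero d}} → c ≤ m ⌊/⌋ d → d * c ≤ m
≤⌊/⌋⇒*≤ {m} {c} d@(suc _) c≤m/d = begin
  d * c        ≤⟨ *-monoʳ-≤ d c≤m/d ⟩
  d * (m / d)  ≡⟨ *-comm d (m / d) ⟩
  m / d * d    ≤⟨ m/n*n≤m m d ⟩
  m            ∎
  where open ≤-Reasoning

m≤n∸1⇒m<n : ∀ {m n} → 0 < n → m ≤ n ∸ 1 → m < n
m≤n∸1⇒m<n {n = suc _} _ = s≤s

-- Since y + y = y forces y = 0, this says y = 0 and z = 0 without a constant for zero.
zeroProduct : ∀ {k} → Fin k → Fin k → Formula k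
zeroProduct y z = A y y y ∧' A z z z

quotientProductMatrix : ∀ {k} (x y z a q r s t u v : Fin k) → Formula k
quotientProductMatrix x y z a q r s t u v =
  M a q s ∧' (A s r x ∧' (M q y t ∧' (M a t u ∧' (M r y v ∧' A u v z))))

quotientProduct : ∀ {k} → Fin k → Fin k → Fin k → Formula k
quotientProduct x y z = ∃' (∃' (∃' (∃' (∃' (∃' (∃' (
  quotientProductMatrix (7 ↑ʳ x) (7 ↑ʳ y) (7 ↑ʳ z) (# 6) (# 5) (# 4) (# 3) (# 2) (# 1) (# 0))))))))

product : ∀ {k} → Fin k → Fin k → Fin k → Formula k
product x y z = M x y z ∨' (zeroProduct y z ∨' quotientProduct x y z)

μ : Formula 3
μ = product (# 0) (# 1) (# 2) ∨' product (# 1) (# 0) (# 2)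

module _ (𝔑 : PartialModel) where
  private
    N : ℕ
    N = n 𝔑

  product-sound : ∀ {k} (x y z : Fin k) (ρ : Vector (Fin N) k) → Sat 𝔑 (product x y z) ρ →
    toℕ (ρ x) * toℕ (ρ y) ≡ toℕ (ρ z)
  product-sound x y z ρ (inj₁ xyz) = M-mul 𝔑 _ _ _ xyz
  product-sound x y z ρ (inj₂ (inj₁ ((_ , _ , _ , y+y≡y) , (_ , _ , _ , z+z≡z)))) = begin
    toℕ (ρ x) * toℕ (ρ y)  ≡⟨ cong (toℕ (ρ x) *_) (m+m≡m⇒m≡0 _ y+y≡y) ⟩
    toℕ (ρ x) * 0          ≡⟨ *-zeroʳ (toℕ (ρ x)) ⟩
    0                      ≡⟨ sym (m+m≡m⇒m≡0 _ z+z≡z) ⟩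
    toℕ (ρ z)              ∎
    where open ≡-Reasoning
  product-sound x y z ρ (inj₂ (inj₂ (a , q , r , _ , _ , _ , _ ,
      aqs , (_ , _ , _ , s+r≡x) , qyt , atu , ryv , (_ , _ , _ , u+v≡z)))) =
    quotient-product (toℕ a) (toℕ q) (toℕ r) (toℕ (ρ y)) (M-mul 𝔑 _ _ _ aqs) s+r≡x (M-mul 𝔑 _ _ _ qyt) (M-mul 𝔑 _ _ _ atu)
                     (M-mul 𝔑 _ _ _ ryv) u+v≡z

  μ-partialMultiplication : PartialMultiplication (μ ^ 𝔑)
  μ-partialMultiplication _ _ _ (i , j , l , refl , refl , refl , inj₁ ijl) =
    product-sound (# 0) (# 1) (# 2) (i ∷ j ∷ l ∷ []) ijl
  μ-partialMultiplication _ _ _ (i , j , l , refl , refl , refl , inj₂ jil) =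
    trans (*-comm (toℕ i) (toℕ j)) (product-sound (# 1) (# 0) (# 2) (i ∷ j ∷ l ∷ []) jil)

  μ-swap : ∀ {a b c} → (μ ^ 𝔑) a b c → (μ ^ 𝔑) b a c
  μ-swap (i , j , l , i≡a , j≡b , l≡c , inj₁ ijl) = j , i , l , j≡b , i≡a , l≡c , inj₂ ijl
  μ-swap (i , j , l , i≡a , j≡b , l≡c , inj₂ jil) = j , i , l , j≡b , i≡a , l≡c , inj₁ jil

  element : ∀ {m} → m < N → Σ (Fin N) λ i → toℕ i ≡ m
  element m<N = fromℕ< m<N , toℕ-fromℕ< m<N

  M⇒μ : ∀ {a b c} → Mrel 𝔑 a b c → (μ ^ 𝔑) a b c
  M⇒μ abc with M-dom 𝔑 _ _ _ abc
  ... | a<N , b<N , c<N with element a<N | element b<N | element c<N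
  ... | i , refl | j , refl | l , refl = i , j , l , refl , refl , refl , inj₁ (inj₁ abc)

  μ-zeroʳ : ∀ {a} → a < N → (μ ^ 𝔑) a 0 0
  μ-zeroʳ a<N with element a<N | element (≤-<-trans z≤n a<N)
  ... | i , refl | o , o≡0 = i , o , o , refl , o≡0 , o≡0 , inj₁ (inj₂ (inj₁ (o+o≡o , o+o≡o)))
    where
    o+o≡o : Arel 𝔑 (toℕ o) (toℕ o) (toℕ o)
    o+o≡o = toℕ<n o , toℕ<n o , toℕ<n o , trans (cong₂ _+_ o≡0 o≡0) (sym o≡0)

  μ-quotient : ∀ {x y z a q r s t u v} → x < N → z < N →
    Mrel 𝔑 a q s → s + r ≡ x → Mrel 𝔑 q y t → Mrel 𝔑 a t u → Mrel 𝔑 r y v → u + v ≡ z →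
    (μ ^ 𝔑) x y z
  μ-quotient x<N z<N aqs s+r≡x qyt atu ryv u+v≡z
    with M-dom 𝔑 _ _ _ aqs | M-dom 𝔑 _ _ _ qyt | M-dom 𝔑 _ _ _ atu | M-dom 𝔑 _ _ _ ryv
  ... | a<N , q<N , s<N | _ , y<N , t<N | _ , _ , u<N | r<N , _ , v<N
    with element x<N | element y<N | element z<N | element a<N | element q<N | element r<N
       | element s<N | element t<N | element u<N | element v<N
  ... | ix , refl | iy , refl | iz , refl | ia , refl | iq , refl | ir , refl
      | is , refl | it , refl | iu , refl | iv , refl =
    ix , iy , iz , refl , refl , refl , inj₁ (inj₂ (inj₂ (ia , iq , ir , is , it , iu , iv ,
      aqs , (s<N , r<N , x<N , s+r≡x) , qyt , atu , ryv , (u<N , v<N , z<N , u+v≡z))))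

  μ-from-MulTable : ∀ {a g} .{{_ : NonZero a}} → MulTable (Mrel 𝔑) a g →
    ∀ x y .{{_ : NonZero y}} → x / a ≤ a → x / a * y ≤ g → y ≤ g → suc x * y < N →
    (μ ^ 𝔑) (suc x) y (suc x * y)
  μ-from-MulTable {a} table x y q≤a qy≤g y≤g [1+x]y<N =
    μ-quotient (≤-<-trans (m≤m*n (suc x) y) [1+x]y<N) [1+x]y<N
      (table a q ≤-refl (≤-trans (m≤m*n q y) qy≤g)) aq+r≡1+x
      (table q y q≤a y≤g) (table a (q * y) ≤-refl qy≤g) (table r y (m%n<n x a) y≤g)
      a[qy]+ry≡[1+x]y
    where
    q : ℕ
    q = x / a
    -- the remainder is shifted into 1..a, so that suc x ≤ b gives q ≤ (b - 1) / a
    r : ℕ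
    r = suc (x % a)
    aq+r≡1+x : a * q + r ≡ suc x
    aq+r≡1+x = begin
      a * q + suc (x % a)  ≡⟨ +-suc (a * q) (x % a) ⟩
      suc (a * q + x % a)  ≡⟨ cong suc (+-comm (a * q) (x % a)) ⟩
      suc (x % a + a * q)  ≡⟨ cong (λ w → suc (x % a + w)) (*-comm a q) ⟩
      suc (x % a + q * a)  ≡⟨ cong suc (sym (m≡m%n+[m/n]*n x a)) ⟩
      suc x                ∎
      where open ≡-Reasoning
    a[qy]+ry≡[1+x]y : a * (q * y) + r * y ≡ suc x * y
    a[qy]+ry≡[1+x]y = trans (sym ([a*q+r]*y≡a*[q*y]+r*y a q r y)) (cong (_* y) aq+r≡1+x)

  μ-GammaCond-lowerBound : ∀ {a b g} → 0 < a → a < b → b ≤ a * a + a → b < N →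
    GammaCond (Mrel 𝔑) a g →
    GammaCond (μ ^ 𝔑) b ((g ⌊/⌋ ((b ∸ 1) ⌊/⌋ a)) ⊓ ((N ∸ 1) ⌊/⌋ b))
  μ-GammaCond-lowerBound {a@(suc _)} {b@(suc b₀)} {g} _ a<b b≤a²+a b<N condM = inj₂ table
    where
    q : ℕ
    q = b₀ / a
    instance
      q≢0 : NonZero q
      q≢0 = >-nonZero (m≥n⇒m/n>0 (s≤s⁻¹ a<b))
    q≤a : q ≤ a
    q≤a = s≤s⁻¹ (m<n*o⇒m/o<n (≤-trans b≤a²+a (≤-reflexive (+-comm (a * a) a))))
    table : MulTable (μ ^ 𝔑) b ((g ⌊/⌋ q) ⊓ ((N ∸ 1) ⌊/⌋ b))
    table b′ zero b′≤b _ = subst ((μ ^ 𝔑) b′ 0) (sym (*-zeroʳ b′)) (μ-zeroʳ (≤-<-trans b′≤b b<N))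
    table b′ c@(suc _) b′≤b c≤min = column b′ b′≤b
      where
      qc≤g : q * c ≤ g
      qc≤g = ≤⌊/⌋⇒*≤ q (≤-trans c≤min (m⊓n≤m _ _))
      c≤g : c ≤ g
      c≤g = ≤-trans (m≤n*m c q) qc≤g
      *c<N : ∀ {x} → x ≤ b → x * c < N
      *c<N x≤b = m≤n∸1⇒m<n (≤-<-trans z≤n b<N)
        (≤-trans (*-monoˡ-≤ c x≤b) (≤⌊/⌋⇒*≤ b (≤-trans c≤min (m⊓n≤n _ _))))
      column : ∀ x → x ≤ b → (μ ^ 𝔑) x c (x * c)
      column zero _ = μ-swap (μ-zeroʳ (≤-<-trans (m≤n*m c b) (*c<N ≤-refl)))
      column (suc x) 1+x≤b = μ-from-MulTable (GammaCond⇒MulTable {Mrel 𝔑} (≤-trans (s≤s z≤n) c≤g) condM)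
        x c (≤-trans x/a≤q q≤a) (≤-trans (*-monoˡ-≤ c x/a≤q) qc≤g) c≤g (*c<N 1+x≤b)
        where
        x/a≤q : x / a ≤ q
        x/a≤q = /-monoˡ-≤ a (s≤s⁻¹ 1+x≤b)

lemma3p1 : Σ (Formula 3) λ μ → (𝔑 : PartialModel) →
    PartialMultiplication (μ ^ 𝔑) ×
    (∀ a b → 0 < a → a < n 𝔑 → 0 < b → b < n 𝔑 →
      (∀ gμa gMa → IsGamma (μ ^ 𝔑) a gμa → IsGamma (Mrel 𝔑) a gMa → gMa ≤ gμa) ×
      (∀ gμa gμb → IsGamma (μ ^ 𝔑) a gμa → IsGamma (μ ^ 𝔑) b gμb → (b ≤ gμa ⇔ a ≤ gμb)) ×
      (a < b → b ≤ a * a + a → ∀ gμb gMa → IsGamma (μ ^ 𝔑) b gμb → IsGamma (Mrel 𝔑) a gMa →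
        (gMa ⌊/⌋ ((b ∸ 1) ⌊/⌋ a)) ⊓ ((n 𝔑 ∸ 1) ⌊/⌋ b) ≤ gμb))
lemma3p1 = μ , λ 𝔑 → μ-partialMultiplication 𝔑 , λ a b 0<a _ 0<b b<N →
  (λ _ _ γμ γM → IsGamma-mono {Mrel 𝔑} {μ ^ 𝔑} (M⇒μ 𝔑) γM γμ) ,
  (λ _ _ γμa γμb → IsGamma-transpose {μ ^ 𝔑} (μ-swap 𝔑) 0<a 0<b γμa γμb) ,
  (λ a<b b≤a²+a _ _ (_ , maximal) (condM , _) →
     maximal _ (μ-GammaCond-lowerBound 𝔑 0<a a<b b≤a²+a b<N condM))
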